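{- Let $(G,\vec{\nu})$ be a signature game such that $\nu_i\geq -2\cdot W\cdot |V|$ for every $\nu_i\in\mathbb{Z}$. Player 1 has a winning strategy in $(G,\vec{\nu})$ if and only if player 1 has a memoryless winning strategy in $(G,\vec{\nu})$.
   Context: Let $G=((V,E),(V_1,V_2))$ be a finite two-player game graph with vertex set $V$ partitioned into player-1 vertices $V_1$ and player-2 vertices $V_2$, initial vertex $v_0$, and weight function $w:E\to\mathbb{Z}\cup\{ -\omega\}$; $W$ is the maximum absolute value of the integer weights. Let $\vec{\nu}=(\nu_1,\dots,\nu_{|V|})$ with $\nu_i\in\mathbb{Z}\cup\{+\infty,-\omega\}$ be a threshold vector indexed by the vertices $v_1,\dots,v_{|V|}$. The weight of a finite path is the sum of its edge weights with the convention $-\omega+z=-\omega$ for $z\in\mathbb{Z}\cup\{ -\omega\}$, and $-\omega<z<+\infty$ for $z\in\mathbb{Z}$. In the signature game $(G,\vec{\nu})$ a play $\rho=\rho_0\rho_1\dots$ starts at $\rho_0=v_0$, player $k$ choosing the successor at vertices of $V_k$; player 1 wins $\rho$ iff (a) $\rho$ contains no cycle (contiguous segment returning to its start vertex) with negative weight or containing an edge of weight $-\omega$, and (b) for every $j$, if $\rho_j=v_i$ then $w(\rho_0\dots\rho_j)\ge\nu_i$. A strategy is winning if every play consistent with it is won by player 1; it is memoryless if its choice depends only on the current vertex. -}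

module Defs where

open import Data.Nat using (ℕ; zero; suc; _⊔_; _*_; _<_) renaming (_+_ to _+ℕ_)
open import Data.Integer as ℤ using (ℤ; +_; -_; ∣_∣) renaming (_≤_ to _≤ℤ_)
open import Data.Fin using (Fin)
open import Data.List using (List; foldr; map; allFin; upTo)
open import Data.Bool using (Bool; true; false)
open import Data.Product using (Σ; ∃; _×_; _,_)
open import Data.Unit using (⊤)
open import Data.Empty using (⊥)
open import Relation.Binary.PropositionalEquality using (_≡_)

data Wt : Set where
  fin  : ℤ → Wt
  -ω   : Wt

data Thr : Set where
  thr  : ℤ → Thr
  +∞   : Thr
  -ωt  : Thr

_⊕_ : Wt → Wt → Wt
fin a ⊕ fin b = fin (a ℤ.+ b)
fin _ ⊕ -ω    = -ω
-ω    ⊕ _     = -ω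

-- "path weight x ≥ threshold t", with -ω < z < +∞ for z ∈ ℤ
_≥ν_ : Wt → Thr → Set
x     ≥ν -ωt    = ⊤
x     ≥ν +∞     = ⊥
fin y ≥ν thr z  = z ≤ℤ y
-ω    ≥ν thr z  = ⊥

data Player : Set where
  P1 P2 : Player

-- A game graph on vertices Fin n: owner gives the partition (V₁,V₂),
-- E the edge relation, w the weight (only meaningful on edges), v₀ initial.
record Game (n : ℕ) : Set where
  field
    owner : Fin n → Player
    E     : Fin n → Fin n → Bool
    w     : Fin n → Fin n → Wt
    v₀    : Fin n

module _ {n : ℕ} (G : Game n) where
  open Game G

  NoDeadEnds : Set
  NoDeadEnds = ∀ v → ∃ λ u → E v u ≡ true

  absW : Fin n → Fin n → ℕ
  absW u v with E u v | w u v
  ... | true  | fin z = ∣ z ∣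
  ... | _     | _     = 0

  maxW : ℕ
  maxW = foldr (λ u acc → foldr (λ v acc' → absW u v ⊔ acc') acc (allFin n)) 0 (allFin n)

  -- a strategy of player 1: given the history ρ₀…ρ_{j-1} and the current vertex ρ_j,
  -- choose a successor; it must follow an edge at player-1 vertices
  record Strategy : Set where
    field
      choose : List (Fin n) → Fin n → Fin n
      legal  : ∀ h v → owner v ≡ P1 → E v (choose h v) ≡ true
  open Strategy public

  Memoryless : Strategy → Set
  Memoryless σ = ∀ h h' v → choose σ h v ≡ choose σ h' v

  Play : Set
  Play = ℕ → Fin n

  prefix : Play → ℕ → List (Fin n)
  prefix ρ j = map ρ (upTo j)

  ConsistentPlay : Strategy → Play → Set
  ConsistentPlay σ ρ =
    (ρ 0 ≡ v₀) ×
    (∀ j → E (ρ j) (ρ (suc j)) ≡ true) ×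
    (∀ j → owner (ρ j) ≡ P1 → ρ (suc j) ≡ choose σ (prefix ρ j) (ρ j))

  segW : Play → ℕ → ℕ → Wt
  segW ρ i zero    = fin (+ 0)
  segW ρ i (suc k) = segW ρ i k ⊕ w (ρ (i +ℕ k)) (ρ (suc (i +ℕ k)))

  NonNeg : Wt → Set
  NonNeg (fin z) = + 0 ≤ℤ z
  NonNeg -ω      = ⊥

  Won : (Fin n → Thr) → Play → Set
  Won ν ρ =
    (∀ i k → 0 < k → ρ i ≡ ρ (i +ℕ k) → NonNeg (segW ρ i k)) ×
    (∀ j → segW ρ 0 j ≥ν ν (ρ j))

  Winning : (Fin n → Thr) → Strategy → Set
  Winning ν σ = ∀ ρ → ConsistentPlay σ ρ → Won ν ρ

ThresholdBound : {n : ℕ} → Game n → (Fin n → Thr) → Set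
ThresholdBound {n} G ν = ∀ i z → ν i ≡ thr z → - (+ (2 * maxW G * n)) ≤ℤ z

module Submission where

-- A memoryless winning strategy is in particular winning.  Conversely, let σ be winning.
-- Summarise a path by its key (c , t): c counts its -ω edges, t is the integer weight
-- since the last one.  Since σ wins, no σ-history contains a negative or -ω cycle, so
-- keys of histories are bounded below (c ≤ n, t ≥ -W·n).  Classically each reachable
-- vertex v therefore has a σ-history of least key; the memoryless τ plays at v what σ
-- plays after it.  Along a τ-play the least keys telescope: each edge raises the key of
-- its target at most by its weight.  Cycles thus have non-negative integer weight and
-- every prefix weighs at least as much as a minimal history, which meets the threshold.
-- This only yields ¬¬(memoryless winning strategy); it is discharged because winning is
-- decidable for memoryless strategies: cycles can be cut out of their plays, so it
-- suffices to inspect the finitely many consistent walks of length 2n.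

open import Defs
open import Data.Nat using (ℕ)
open import Data.Fin using (Fin)
open import Data.Product using (Σ; _×_)
open import Function.Bundles using (_⇔_)

open import Function.Bundles using (mk⇔)
open import Data.Nat using (zero; suc; _+_; _*_; _∸_; _⊔_; _≤_; _<_; _≤?_; _<?_; z≤n; s≤s; s≤s⁻¹)
import Data.Nat.Properties as ℕP
open import Data.Nat.Induction using (<-rec)
import Data.Nat.Tactic.RingSolver as ℕSolver
open import Data.Integer as ℤ using (ℤ; +_; -_; +≤+) renaming (_≤_ to _≤ℤ_; _+_ to _+ℤ_)
import Data.Integer.Properties as ℤP
import Data.Integer.Tactic.RingSolver as ℤSolver
open import Data.Fin as Fin using (toℕ)
import Data.Fin.Properties as FinP
open import Data.Vec as Vec using (Vec; []; _∷_)
import Data.Vec.Properties as VecP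
open import Data.List using (List; []; _∷_; _∷ʳ_; foldr; map; upTo; length; filter; allFin)
import Data.List.Properties as ListP
open import Data.List.Relation.Unary.Any as Any using (here; there)
open import Data.List.Membership.Propositional using (_∈_)
open import Data.List.Membership.Propositional.Properties using (∈-allFin; ∈-filter⁺)
open import Data.Product using (∃₂; proj₁; proj₂; _,_)
open import Data.Sum using (_⊎_; inj₁; inj₂)
open import Data.Unit using (⊤; tt)
open import Data.Bool as Bool using (true)
open import Data.Empty using (⊥; ⊥-elim)
open import Relation.Nullary using (¬_; ¬?; Dec; yes; no)
open import Relation.Nullary.Negation using (¬¬-map)
open import Relation.Nullary.Decidable as Dec using (¬¬-excluded-middle; decidable-stable; _→-dec_; _×-dec_)
open import Relation.Binary.PropositionalEquality

_≤w_ : Wt → Wt → Set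
-ω    ≤w _     = ⊤
fin a ≤w fin b = a ≤ℤ b
fin _ ≤w -ω    = ⊥

≥ν-mono : ∀ {x y} t → x ≤w y → x ≥ν t → y ≥ν t
≥ν-mono {fin _} {fin _} (thr _) x≤y z≤x = ℤP.≤-trans z≤x x≤y
≥ν-mono {fin _} { -ω}   (thr _) ()  _
≥ν-mono { -ω}           (thr _) _   ()
≥ν-mono                 -ωt     _   _   = tt

⊕-assoc : ∀ x y z → (x ⊕ y) ⊕ z ≡ x ⊕ (y ⊕ z)
⊕-assoc (fin a) (fin b) (fin c) = cong fin (ℤP.+-assoc a b c)
⊕-assoc (fin _) (fin _) -ω      = refl
⊕-assoc (fin _) -ω      _       = refl
⊕-assoc -ω      _       _       = refl

⊕-identityʳ : ∀ x → x ⊕ fin (+ 0) ≡ x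
⊕-identityʳ (fin a) = cong fin (ℤP.+-identityʳ a)
⊕-identityʳ -ω      = refl

+-cancelˡ-≤ : ∀ c a b → c +ℤ a ≤ℤ c +ℤ b → a ≤ℤ b
+-cancelˡ-≤ c a b le = subst₂ _≤ℤ_ (cancel c a) (cancel c b) (ℤP.+-monoʳ-≤ (- c) le)
  where
  cancel : ∀ c x → (- c) +ℤ (c +ℤ x) ≡ x
  cancel = ℤSolver.solve-∀

record Above (X : ℕ) (t : ℤ) : Set where
  constructor above
  field bound : - (+ X) ≤ℤ t

above-0 : ∀ X → Above X (+ 0)
above-0 X = above ℤP.neg-≤-pos

above-+ : ∀ {X Y t u} → Above X t → Above Y u → Above (X + Y) (t +ℤ u)
above-+ {X} {Y} (above t≥) (above u≥) = above (subst (_≤ℤ _) (sym neg-sum) (ℤP.+-mono-≤ t≥ u≥))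
  where
  neg-sum : - (+ (X + Y)) ≡ - (+ X) +ℤ - (+ Y)
  neg-sum = trans (cong -_ (ℤP.pos-+ X Y)) (ℤP.neg-distrib-+ (+ X) (+ Y))

above-weaken : ∀ {X X′ t} → X ≤ X′ → Above X t → Above X′ t
above-weaken X≤X′ (above t≥) = above (ℤP.≤-trans (ℤP.neg-mono-≤ (+≤+ X≤X′)) t≥)

above-nonneg : ∀ {X t z} → + 0 ≤ℤ z → Above X t → Above X (t +ℤ z)
above-nonneg {t = t} z≥0 (above t≥) =
  above (ℤP.≤-trans t≥ (subst (_≤ℤ t +ℤ _) (ℤP.+-identityʳ t) (ℤP.+-monoʳ-≤ t z≥0)))

above-∣∣ : ∀ y → Above ℤ.∣ y ∣ y
above-∣∣ (+ k)       = above ℤP.neg-≤-pos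
above-∣∣ ℤ.-[1+ k ] = above ℤP.≤-refl

-- A key (c , t) summarises the weight of a path: c counts its -ω edges and t is the
-- integer weight accumulated since the last of them.
Key : Set
Key = ℕ × ℤ

stepK : Key → Wt → Key
stepK (c , t) (fin z) = c , t +ℤ z
stepK (c , _) -ω      = suc c , + 0

_⊑_ : Key → Key → Set
(c , t) ⊑ (c′ , t′) = c′ < c ⊎ (c ≡ c′ × t ≤ℤ t′)

⊑-refl : ∀ κ → κ ⊑ κ
⊑-refl _ = inj₂ (refl , ℤP.≤-refl)

⊑-trans : ∀ {κ κ′ κ″} → κ ⊑ κ′ → κ′ ⊑ κ″ → κ ⊑ κ″
⊑-trans (inj₁ c′<c)        (inj₁ c″<c′)        = inj₁ (ℕP.<-trans c″<c′ c′<c)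
⊑-trans (inj₁ c′<c)        (inj₂ (refl , _))   = inj₁ c′<c
⊑-trans (inj₂ (refl , _))  (inj₁ c″<c′)        = inj₁ c″<c′
⊑-trans (inj₂ (refl , t≤)) (inj₂ (refl , t′≤)) = inj₂ (refl , ℤP.≤-trans t≤ t′≤)

stepK-mono : ∀ {κ κ′} x → κ ⊑ κ′ → stepK κ x ⊑ stepK κ′ x
stepK-mono (fin _) (inj₁ c′<c)        = inj₁ c′<c
stepK-mono (fin z) (inj₂ (refl , t≤)) = inj₂ (refl , ℤP.+-monoˡ-≤ z t≤)
stepK-mono -ω      (inj₁ c′<c)        = inj₁ (s≤s c′<c)
stepK-mono -ω      (inj₂ (refl , _))  = ⊑-refl _

-- The weight of a path whose key, counted from the empty path, is the given one.
weightOf : Key → Wt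
weightOf (zero  , t) = fin t
weightOf (suc _ , _) = -ω

weightOf-mono : ∀ {κ κ′} → κ ⊑ κ′ → weightOf κ ≤w weightOf κ′
weightOf-mono {zero  , _} (inj₁ ())
weightOf-mono {suc _ , _} (inj₁ _)           = tt
weightOf-mono {zero  , _} (inj₂ (refl , t≤)) = t≤
weightOf-mono {suc _ , _} (inj₂ (refl , _))  = tt

-- Extends κ s κ′: the key κ′ arises from κ by appending a path of weight s.
Extends : Key → Wt → Key → Set
Extends (c , t) s (c′ , t′) =
  (c < c′ × s ≡ -ω) ⊎ (Σ ℤ λ z → c′ ≡ c × t′ ≡ t +ℤ z × s ≡ fin z)

extends-[] : ∀ κ → Extends κ (fin (+ 0)) κ
extends-[] (_ , t) = inj₂ (+ 0 , refl , sym (ℤP.+-identityʳ t) , refl)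

extends-∷ʳ : ∀ κ {κ′ s} e → Extends κ s κ′ → Extends κ (s ⊕ e) (stepK κ′ e)
extends-∷ʳ _ (fin _) (inj₁ (c<c′ , refl))                 = inj₁ (c<c′ , refl)
extends-∷ʳ _ -ω      (inj₁ (c<c′ , refl))                 = inj₁ (ℕP.m≤n⇒m≤1+n c<c′ , refl)
extends-∷ʳ (_ , t) (fin y) (inj₂ (z , refl , refl , refl)) = inj₂ (z +ℤ y , refl , ℤP.+-assoc t z y , refl)
extends-∷ʳ _ -ω      (inj₂ (_ , refl , _ , refl))          = inj₁ (ℕP.≤-refl , refl)

extends-weightOf : ∀ {κ s} → Extends (0 , + 0) s κ → weightOf κ ≡ s
extends-weightOf {zero  , _} (inj₁ (() , _))
extends-weightOf {suc _ , _} (inj₁ (_ , refl))                = refl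
extends-weightOf {zero  , _} (inj₂ (z , refl , refl , refl)) = cong fin (ℤP.+-identityˡ z)

-- On keys with at most N edges -ω and integer part at least -B, the order ⊑ is
-- reflected by the lexicographic order on the pair of naturals (N ∸ c , ∣ B + t ∣);
-- this reduces the existence of ⊑-least keys to a least-number principle on ℕ.
rank : ℕ → ℕ → Key → ℕ × ℕ
rank N B (c , t) = N ∸ c , ℤ.∣ + B +ℤ t ∣

rank-⊑ : ∀ {N B c c′ t t′} → c ≤ N → c′ ≤ N → Above B t → Above B t′ →
         let (a , b) = rank N B (c , t) ; (a′ , b′) = rank N B (c′ , t′) in
         a < a′ ⊎ (a ≡ a′ × b ≤ b′) → (c , t) ⊑ (c′ , t′)
rank-⊑ c≤N c′≤N _ _ (inj₁ a<a′) = inj₁ (ℕP.∸-cancelʳ-< a<a′)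
rank-⊑ {N} {B} {c} {c′} {t} {t′} c≤N c′≤N t≥ t′≥ (inj₂ (a≡a′ , b≤b′)) =
  inj₂ (ℕP.∸-cancelˡ-≡ c≤N c′≤N a≡a′ ,
        +-cancelˡ-≤ (+ B) t t′ (subst₂ _≤ℤ_ (shifted t≥) (shifted t′≥) (+≤+ b≤b′)))
  where
  shifted : ∀ {u} → Above B u → + ℤ.∣ + B +ℤ u ∣ ≡ + B +ℤ u
  shifted {u} (above u≥) = ℤP.0≤i⇒+∣i∣≡i
    (subst (_≤ℤ + B +ℤ u) (ℤP.+-inverseʳ (+ B)) (ℤP.+-monoʳ-≤ (+ B) u≥))

graft : ∀ {A : Set} → (ℕ → A) → ℕ → A → ℕ → A
graft ρ j u m with m ≤? j
... | yes _ = ρ m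
... | no  _ = u

graft-≤ : ∀ {A : Set} (ρ : ℕ → A) j u m → m ≤ j → graft ρ j u m ≡ ρ m
graft-≤ ρ j u m m≤j with m ≤? j
... | yes _   = refl
... | no  m≰j = ⊥-elim (m≰j m≤j)

graft-suc : ∀ {A : Set} (ρ : ℕ → A) j u → graft ρ j u (suc j) ≡ u
graft-suc ρ j u with suc j ≤? j
... | yes 1+j≤j = ⊥-elim (ℕP.<-irrefl refl 1+j≤j)
... | no  _     = refl

-- ρ with the positions b + 1, …, b + d removed; used when ρ_b = ρ_{b+d}, so that the
-- removed part is a cycle.
cut : ∀ {A : Set} → (ℕ → A) → ℕ → ℕ → ℕ → A
cut ρ b d m with m ≤? b
... | yes _ = ρ m
... | no  _ = ρ (m + d)

cut-≤ : ∀ {A : Set} (ρ : ℕ → A) b d m → m ≤ b → cut ρ b d m ≡ ρ m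
cut-≤ ρ b d m m≤b with m ≤? b
... | yes _   = refl
... | no  m≰b = ⊥-elim (m≰b m≤b)

cut-> : ∀ {A : Set} (ρ : ℕ → A) b d m → b < m → cut ρ b d m ≡ ρ (m + d)
cut-> ρ b d m b<m with m ≤? b
... | yes m≤b = ⊥-elim (ℕP.<⇒≱ b<m m≤b)
... | no  _   = refl

cut-after : ∀ {A : Set} (ρ : ℕ → A) b d → ρ b ≡ ρ (b + d) → ∀ t → cut ρ b d (b + t) ≡ ρ (b + d + t)
cut-after ρ b d ρb≡ zero = begin
  cut ρ b d (b + 0) ≡⟨ cut-≤ ρ b d (b + 0) (ℕP.≤-reflexive (ℕP.+-identityʳ b)) ⟩
  ρ (b + 0)         ≡⟨ cong ρ (ℕP.+-identityʳ b) ⟩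
  ρ b               ≡⟨ ρb≡ ⟩
  ρ (b + d)         ≡⟨ cong ρ (sym (ℕP.+-identityʳ (b + d))) ⟩
  ρ (b + d + 0)     ∎
  where open ≡-Reasoning
cut-after ρ b d _ (suc t) =
  trans (cut-> ρ b d (b + suc t) (ℕP.m<m+n b (s≤s z≤n))) (cong ρ (arith b (suc t) d))
  where
  arith : ∀ b t d → b + t + d ≡ b + d + t
  arith = ℕSolver.solve-∀

seqOf : ∀ {A : Set} {L} → Vec A (suc L) → ℕ → A
seqOf             (a ∷ _)        zero    = a
seqOf {L = zero}  (a ∷ [])       (suc _) = a
seqOf {L = suc L} (_ ∷ as)       (suc m) = seqOf as m

seqOf-tabulate : ∀ {A : Set} L (f : ℕ → A) m → m ≤ L → seqOf (Vec.tabulate {n = suc L} (λ i → f (toℕ i))) m ≡ f m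
seqOf-tabulate L       f zero    _        = refl
seqOf-tabulate (suc L) f (suc m) 1+m≤1+L = seqOf-tabulate L (λ i → f (suc i)) m (s≤s⁻¹ 1+m≤1+L)

foldr-⊔-acc : ∀ {A : Set} (f : A → ℕ) acc xs → acc ≤ foldr (λ x m → f x ⊔ m) acc xs
foldr-⊔-acc f acc []       = ℕP.≤-refl
foldr-⊔-acc f acc (x ∷ xs) = ℕP.m≤n⇒m≤o⊔n (f x) (foldr-⊔-acc f acc xs)

foldr-⊔-elem : ∀ {A : Set} (f : A → ℕ) acc {x} xs → x ∈ xs → f x ≤ foldr (λ x m → f x ⊔ m) acc xs
foldr-⊔-elem f acc (x ∷ xs) (here refl) = ℕP.m≤m⊔n (f x) _
foldr-⊔-elem f acc (x ∷ xs) (there x∈) = ℕP.m≤n⇒m≤o⊔n (f x) (foldr-⊔-elem f acc xs x∈)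

_without_ : ∀ {m} → List (Fin m) → Fin m → List (Fin m)
xs without v = filter (λ u → ¬? (u FinP.≟ v)) xs

without-shorter : ∀ {m} {v : Fin m} xs → v ∈ xs → length (xs without v) < length xs
without-shorter xs v∈xs = ListP.filter-notAll _ xs (Any.map (λ { refl v≢v → v≢v refl }) v∈xs)

without-∈ : ∀ {m} {u v : Fin m} {xs} → u ∈ xs → u ≢ v → u ∈ xs without v
without-∈ = ∈-filter⁺ _

-- Classical reasoning is confined to double-negated statements.  The
-- least-number principle: an inhabited predicate on ℕ has, not-not, a least witness.
Least : (ℕ → Set) → Set
Least P = Σ ℕ λ m → P m × (∀ m′ → P m′ → m ≤ m′)

¬¬-least : (P : ℕ → Set) (m : ℕ) → P m → ¬ ¬ Least P
¬¬-least P = <-rec (λ m → P m → ¬ ¬ Least P) step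
  where
  step : ∀ m → (∀ {k} → k < m → P k → ¬ ¬ Least P) → P m → ¬ ¬ Least P
  step m smaller pm noLeast = ¬¬-excluded-middle {A = Σ ℕ λ k → k < m × P k} λ where
    (yes (k , k<m , pk)) → smaller k<m pk noLeast
    (no none) → noLeast (m , pm , λ k pk → ℕP.≮⇒≥ λ k<m → none (k , k<m , pk))

LexLeast : (ℕ → ℕ → Set) → Set
LexLeast P = ∃₂ λ a b → P a b × (∀ a′ b′ → P a′ b′ → a < a′ ⊎ (a ≡ a′ × b ≤ b′))

¬¬-lexLeast : (P : ℕ → ℕ → Set) (a b : ℕ) → P a b → ¬ ¬ LexLeast P
¬¬-lexLeast P a b pab noLeast =
  ¬¬-least (λ a → Σ ℕ (P a)) a (b , pab) λ where
    (a* , (b₀ , pa*b₀) , a*-least) → ¬¬-least (P a*) b₀ pa*b₀ λ where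
      (b* , pa*b* , b*-least) → noLeast (a* , b* , pa*b* , λ a′ b′ pa′b′ →
        lex a′ b′ pa′b′ (a*-least a′ (b′ , pa′b′)) b*-least)
  where
  lex : ∀ {a* b*} a′ b′ → P a′ b′ → a* ≤ a′ → (∀ b → P a* b → b* ≤ b) →
        a* < a′ ⊎ (a* ≡ a′ × b* ≤ b′)
  lex a′ b′ pa′b′ a*≤a′ b*-least with ℕP.m≤n⇒m<n∨m≡n a*≤a′
  ... | inj₁ a*<a′ = inj₁ a*<a′
  ... | inj₂ refl  = inj₂ (refl , b*-least b′ pa′b′)

¬¬-finiteChoice : ∀ {m} (B : Fin m → Set) → (∀ v → ¬ ¬ B v) → ¬ ¬ (∀ v → B v)
¬¬-finiteChoice {zero}  B _  noChoice = noChoice λ ()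
¬¬-finiteChoice {suc m} B ¬¬B noChoice = ¬¬B Fin.zero λ b₀ →
  ¬¬-finiteChoice (λ v → B (Fin.suc v)) (λ v → ¬¬B (Fin.suc v)) λ bₛ →
    noChoice λ where Fin.zero → b₀ ; (Fin.suc v) → bₛ v

_≥ν?_ : ∀ x t → Dec (x ≥ν t)
fin y ≥ν? thr z = z ℤ.≤? y
-ω    ≥ν? thr _ = no λ ()
_     ≥ν? +∞    = no λ ()
_     ≥ν? -ωt   = yes tt

isP1? : ∀ p → Dec (p ≡ P1)
isP1? P1 = yes refl
isP1? P2 = no λ ()

all<? : ∀ {P : ℕ → Set} → (∀ m → Dec (P m)) → ∀ B → Dec (∀ m → m < B → P m)
all<? P? B = Dec.map′ (λ all m → all {m}) (λ all {m} → all m) (ℕP.allUpTo? P? B)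

allVec? : ∀ {k} m {P : Vec (Fin k) m → Set} → (∀ x → Dec (P x)) → Dec (∀ x → P x)
allVec? zero P? with P? []
... | yes p  = yes λ where [] → p
... | no ¬p  = no λ all → ¬p (all [])
allVec? (suc m) P? with allVec? m (λ xs → FinP.all? λ a → P? (a ∷ xs))
... | yes all = yes λ where (a ∷ xs) → all xs a
... | no ¬all = no λ all → ¬all λ xs a → all (a ∷ xs)

anyVec? : ∀ {k} m {P : Vec (Fin k) m → Set} → (∀ x → Dec (P x)) → Dec (Σ (Vec (Fin k) m) P)
anyVec? zero P? with P? []
... | yes p = yes ([] , p)
... | no ¬p = no λ where ([] , p) → ¬p p
anyVec? (suc m) P? with anyVec? m (λ xs → FinP.any? λ a → P? (a ∷ xs))
... | yes (xs , a , p) = yes (a ∷ xs , p)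
... | no ¬any = no λ where (a ∷ xs , p) → ¬any (xs , a , p)

module _ {n : ℕ} (G : Game n) where
  open Game G

  NN : Wt → Set
  NN = NonNeg G

  nn? : ∀ x → Dec (NN x)
  nn? (fin z) = + 0 ℤ.≤? z
  nn? -ω      = no λ ()

  nn-mono : ∀ {x y} → NN x → x ≤w y → NN y
  nn-mono {fin _} {fin _} 0≤x x≤y = ℤP.≤-trans 0≤x x≤y
  nn-mono {fin _} { -ω}   _   ()
  nn-mono { -ω}           ()  _

  nn-insert : ∀ x c y → NN c → (x ⊕ y) ≤w ((x ⊕ c) ⊕ y)
  nn-insert -ω      _       _       _   = tt
  nn-insert (fin _) (fin _) -ω      _   = tt
  nn-insert (fin a) (fin z) (fin b) 0≤z =
    ℤP.+-monoˡ-≤ b (subst (_≤ℤ a +ℤ z) (ℤP.+-identityʳ a) (ℤP.+-monoʳ-≤ a 0≤z))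
  nn-insert (fin _) -ω      _       ()

  extends-⊑⇒nn : ∀ {κ κ′ s} → Extends κ s κ′ → κ ⊑ κ′ → NN s
  extends-⊑⇒nn (inj₁ (c<c′ , _)) (inj₁ c′<c)      = ⊥-elim (ℕP.<-asym c<c′ c′<c)
  extends-⊑⇒nn (inj₁ (c<c′ , _)) (inj₂ (refl , _)) = ⊥-elim (ℕP.<-irrefl refl c<c′)
  extends-⊑⇒nn (inj₂ (_ , refl , _ , _)) (inj₁ c<c) = ⊥-elim (ℕP.<-irrefl refl c<c)
  extends-⊑⇒nn {_ , t} (inj₂ (z , refl , refl , refl)) (inj₂ (_ , t≤t+z)) =
    +-cancelˡ-≤ t (+ 0) z (subst (_≤ℤ t +ℤ z) (sym (ℤP.+-identityʳ t)) t≤t+z)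

  extends-nn : ∀ {X c t κ′ s} → Extends (c , t) s κ′ → NN s → Above X t →
               proj₁ κ′ ≡ c × Above X (proj₂ κ′)
  extends-nn (inj₁ (_ , refl)) ()
  extends-nn (inj₂ (_ , refl , refl , refl)) 0≤z t≥ = refl , above-nonneg 0≤z t≥

  segW-++ : ∀ ρ i k₁ k₂ → segW G ρ i (k₁ + k₂) ≡ segW G ρ i k₁ ⊕ segW G ρ (i + k₁) k₂
  segW-++ ρ i k₁ zero rewrite ℕP.+-identityʳ k₁ = sym (⊕-identityʳ _)
  segW-++ ρ i k₁ (suc k) rewrite ℕP.+-suc k₁ k | segW-++ ρ i k₁ k | ℕP.+-assoc i k₁ k =
    ⊕-assoc _ _ _

  edge-cong : ∀ ρ ρ′ i i′ k → (∀ t → t ≤ suc k → ρ (i + t) ≡ ρ′ (i′ + t)) →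
              w (ρ (i + k)) (ρ (suc (i + k))) ≡ w (ρ′ (i′ + k)) (ρ′ (suc (i′ + k)))
  edge-cong ρ ρ′ i i′ k same = cong₂ w (same k (ℕP.n≤1+n k)) (begin
    ρ (suc (i + k))   ≡⟨ cong ρ (sym (ℕP.+-suc i k)) ⟩
    ρ (i + suc k)     ≡⟨ same (suc k) ℕP.≤-refl ⟩
    ρ′ (i′ + suc k)   ≡⟨ cong ρ′ (ℕP.+-suc i′ k) ⟩
    ρ′ (suc (i′ + k)) ∎)
    where open ≡-Reasoning

  segW-cong : ∀ ρ ρ′ i i′ k → (∀ t → t ≤ k → ρ (i + t) ≡ ρ′ (i′ + t)) →
              segW G ρ i k ≡ segW G ρ′ i′ k
  segW-cong ρ ρ′ i i′ zero    _    = refl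
  segW-cong ρ ρ′ i i′ (suc k) same =
    cong₂ _⊕_ (segW-cong ρ ρ′ i i′ k (λ t t≤k → same t (ℕP.m≤n⇒m≤1+n t≤k)))
              (edge-cong ρ ρ′ i i′ k same)

  keyFrom : Key → Play G → ℕ → ℕ → Key
  keyFrom κ ρ i zero    = κ
  keyFrom κ ρ i (suc k) = stepK (keyFrom κ ρ i k) (w (ρ (i + k)) (ρ (suc (i + k))))

  keyFrom-++ : ∀ κ ρ i k₁ k₂ → keyFrom κ ρ i (k₁ + k₂) ≡ keyFrom (keyFrom κ ρ i k₁) ρ (i + k₁) k₂
  keyFrom-++ κ ρ i k₁ zero rewrite ℕP.+-identityʳ k₁ = refl
  keyFrom-++ κ ρ i k₁ (suc k) rewrite ℕP.+-suc k₁ k | keyFrom-++ κ ρ i k₁ k | ℕP.+-assoc i k₁ k = refl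

  keyFrom-cong : ∀ κ ρ ρ′ i i′ k → (∀ t → t ≤ k → ρ (i + t) ≡ ρ′ (i′ + t)) →
                 keyFrom κ ρ i k ≡ keyFrom κ ρ′ i′ k
  keyFrom-cong κ ρ ρ′ i i′ zero    _    = refl
  keyFrom-cong κ ρ ρ′ i i′ (suc k) same =
    cong₂ stepK (keyFrom-cong κ ρ ρ′ i i′ k (λ t t≤k → same t (ℕP.m≤n⇒m≤1+n t≤k)))
                (edge-cong ρ ρ′ i i′ k same)

  keyFrom-mono : ∀ {κ κ′} ρ i k → κ ⊑ κ′ → keyFrom κ ρ i k ⊑ keyFrom κ′ ρ i k
  keyFrom-mono ρ i zero    κ⊑κ′ = κ⊑κ′
  keyFrom-mono ρ i (suc k) κ⊑κ′ = stepK-mono (w (ρ (i + k)) (ρ (suc (i + k)))) (keyFrom-mono ρ i k κ⊑κ′)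

  keyFrom-extends : ∀ κ ρ i k → Extends κ (segW G ρ i k) (keyFrom κ ρ i k)
  keyFrom-extends κ ρ i zero    = extends-[] κ
  keyFrom-extends κ ρ i (suc k) = extends-∷ʳ κ _ (keyFrom-extends κ ρ i k)

  keyFrom-nn : ∀ κ ρ i k → κ ⊑ keyFrom κ ρ i k → NN (segW G ρ i k)
  keyFrom-nn κ ρ i k = extends-⊑⇒nn (keyFrom-extends κ ρ i k)

  weightOf-keyFrom : ∀ ρ j → weightOf (keyFrom (0 , + 0) ρ 0 j) ≡ segW G ρ 0 j
  weightOf-keyFrom ρ j = extends-weightOf (keyFrom-extends (0 , + 0) ρ 0 j)

  absW≤maxW : ∀ u v → absW G u v ≤ maxW G
  absW≤maxW u v = outer (allFin n) (∈-allFin u)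
    where
    row : Fin n → ℕ → ℕ
    row u acc = foldr (λ v m → absW G u v ⊔ m) acc (allFin n)
    outer : ∀ us → u ∈ us → absW G u v ≤ foldr row 0 us
    outer (u ∷ us) (here refl) = foldr-⊔-elem (absW G u) _ (allFin n) (∈-allFin v)
    outer (x ∷ us) (there u∈)  = ℕP.≤-trans (outer us u∈) (foldr-⊔-acc (absW G x) _ (allFin n))

  EdgeWeight : Wt → Set
  EdgeWeight x = (x ≡ -ω) ⊎ (Σ ℤ λ y → x ≡ fin y × Above (maxW G) y)

  edgeWeight : ∀ u v → E u v ≡ true → EdgeWeight (w u v)
  edgeWeight u v uv with E u v | w u v | absW≤maxW u v
  ... | true | -ω    | _     = inj₁ refl
  ... | true | fin y | ∣y∣≤W = inj₂ (y , refl , above-weaken ∣y∣≤W (above-∣∣ y))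

  NoBadCycle : Play G → Set
  NoBadCycle ρ = ∀ i k → 0 < k → ρ i ≡ ρ (i + k) → NN (segW G ρ i k)

  FollowsEdges : Play G → Set
  FollowsEdges ρ = ∀ j → E (ρ j) (ρ (suc j)) ≡ true

  record LastVisit (ρ : Play G) (a k : ℕ) : Set where
    field
      pos   : ℕ
      pos≤k : pos ≤ k
      back  : ρ (a + pos) ≡ ρ a
      after : ∀ q → pos < q → q ≤ k → ρ (a + q) ≢ ρ a

  lastVisit : ∀ ρ a k → LastVisit ρ a k
  lastVisit ρ a zero = record
    { pos = 0 ; pos≤k = z≤n ; back = cong ρ (ℕP.+-identityʳ a)
    ; after = λ q 0<q q≤0 → ⊥-elim (ℕP.<⇒≱ 0<q q≤0) }
  lastVisit ρ a (suc k) with ρ (a + suc k) FinP.≟ ρ a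
  ... | yes back = record
    { pos = suc k ; pos≤k = ℕP.≤-refl ; back = back
    ; after = λ q k<q q≤k → ⊥-elim (ℕP.<⇒≱ k<q q≤k) }
  ... | no away = record
    { pos = pos ; pos≤k = ℕP.m≤n⇒m≤1+n pos≤k ; back = back ; after = after′ }
    where
    open LastVisit (lastVisit ρ a k)
    after′ : ∀ q → pos < q → q ≤ suc k → ρ (a + q) ≢ ρ a
    after′ q pos<q q≤ with ℕP.m≤n⇒m<n∨m≡n q≤
    ... | inj₁ q<1+k = after q pos<q (s≤s⁻¹ q<1+k)
    ... | inj₂ refl  = away

  Within : ℕ → ℕ → ℕ → Key → Set
  Within c₀ X L (c , t) = c ≤ c₀ + L × Above (X + maxW G * L) t

  within-mono : ∀ {c₀ X L L′ κ} → L ≤ L′ → Within c₀ X L κ → Within c₀ X L′ κ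
  within-mono {c₀} {X} L≤L′ (c≤ , t≥) =
    ℕP.≤-trans c≤ (ℕP.+-monoʳ-≤ c₀ L≤L′) ,
    above-weaken (ℕP.+-monoʳ-≤ X (ℕP.*-monoʳ-≤ (maxW G) L≤L′)) t≥

  within-step : ∀ {c₀ X L} κ → Within (suc c₀) (X + maxW G) L κ → Within c₀ X (suc L) κ
  within-step {c₀} {X} {L} (c , t) (c≤ , t≥) =
    subst (c ≤_) (sym (ℕP.+-suc c₀ L)) c≤ ,
    subst (λ B → Above B t) (arith X (maxW G) L) t≥
    where
    arith : ∀ X W L → X + W + W * L ≡ X + W * suc L
    arith = ℕSolver.solve-∀

  -- Along a play without bad cycles, the key of any segment is bounded in terms of the
  -- number of distinct vertices it visits: cycles never decrease the key, so only the
  -- last visit of each vertex matters, and each vertex is left at most once by an edge.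
  module _ {ρ : Play G} (noBad : NoBadCycle ρ) (edges : FollowsEdges ρ) where

    Start : ℕ → ℕ → Key → Set
    Start c₀ X (c , t) = c ≤ c₀ × Above X t

    cycleKey : ∀ {c₀ X} a p κ → ρ (a + p) ≡ ρ a → Start c₀ X κ → Start c₀ X (keyFrom κ ρ a p)
    cycleKey a p (c , t) back (c≤ , t≥) =
      let (same , t′≥) = extends-nn (keyFrom-extends (c , t) ρ a p) (returnNN p back) t≥
      in subst (_≤ _) (sym same) c≤ , t′≥
      where
      returnNN : ∀ p → ρ (a + p) ≡ ρ a → NN (segW G ρ a p)
      returnNN zero    _    = ℤP.≤-refl
      returnNN (suc p) back = noBad a (suc p) (s≤s z≤n) (sym back)

    edgeKey : ∀ {c₀ X} j κ → Start c₀ X κ →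
              Start (suc c₀) (X + maxW G) (stepK κ (w (ρ j) (ρ (suc j))))
    edgeKey {c₀} {X} j (c , t) (c≤ , t≥) with w (ρ j) (ρ (suc j)) | edgeWeight _ _ (edges j)
    ... | .-ω      | inj₁ refl             = s≤s c≤ , above-0 _
    ... | .(fin y) | inj₂ (y , refl , y≥) = ℕP.m≤n⇒m≤1+n c≤ , above-+ t≥ y≥

    keyWithin : ∀ m (Ls : List (Fin n)) → length Ls ≤ m → ∀ {c₀ X} a k κ → Start c₀ X κ →
                (∀ t → t ≤ k → ρ (a + t) ∈ Ls) → Within c₀ X (length Ls) (keyFrom κ ρ a k)
    keyWithin zero []      _  a k κ _ visits with visits 0 z≤n
    ... | ()
    keyWithin zero (_ ∷ _) ()
    keyWithin (suc m) Ls |Ls|≤ {c₀} {X} a k κ start visits with lastVisit ρ a k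
    ... | record { pos = p ; pos≤k = p≤k ; back = back ; after = after }
      with ℕP.m≤n⇒m<n∨m≡n p≤k
    ... | inj₂ refl =
      let (c≤ , t≥) = cycleKey a p κ back start
      in ℕP.≤-trans c≤ (ℕP.m≤m+n c₀ _) , above-weaken (ℕP.m≤m+n X _) t≥
    ... | inj₁ p<k = subst (Within c₀ X (length Ls)) (sym split)
      (within-mono |Ls′|<|Ls| (within-step (keyFrom κ₁ ρ (a + suc p) r) rest))
      where
      r = proj₁ (ℕP.m≤n⇒∃[o]m+o≡n p<k)
      p+r≡k : suc p + r ≡ k
      p+r≡k = proj₂ (ℕP.m≤n⇒∃[o]m+o≡n p<k)
      κ₁ = stepK (keyFrom κ ρ a p) (w (ρ (a + p)) (ρ (suc (a + p))))
      split : keyFrom κ ρ a k ≡ keyFrom κ₁ ρ (a + suc p) r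
      split = trans (cong (keyFrom κ ρ a) (sym p+r≡k)) (keyFrom-++ κ ρ a (suc p) r)
      Ls′ = Ls without ρ a
      |Ls′|<|Ls| : length Ls′ < length Ls
      |Ls′|<|Ls| = without-shorter Ls (subst (_∈ Ls) (cong ρ (ℕP.+-identityʳ a)) (visits 0 z≤n))
      visits′ : ∀ t → t ≤ r → ρ (a + suc p + t) ∈ Ls′
      visits′ t t≤r = subst (_∈ Ls′) (cong ρ (sym (ℕP.+-assoc a (suc p) t)))
        (without-∈ (visits (suc p + t) t′≤k) (after (suc p + t) (s≤s (ℕP.m≤m+n p t)) t′≤k))
        where
        t′≤k : suc p + t ≤ k
        t′≤k = subst (suc p + t ≤_) p+r≡k (ℕP.+-monoʳ-≤ (suc p) t≤r)
      rest : Within (suc c₀) (X + maxW G) (length Ls′) (keyFrom κ₁ ρ (a + suc p) r)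
      rest = keyWithin m Ls′ (s≤s⁻¹ (ℕP.<-≤-trans |Ls′|<|Ls| |Ls|≤)) (a + suc p) r κ₁
               (edgeKey (a + p) _ (cycleKey a p κ back start)) visits′

  prefix-suc : ∀ ρ m → prefix G ρ (suc m) ≡ prefix G ρ m ∷ʳ ρ m
  prefix-suc ρ m = trans (cong (map ρ) (sym (ListP.upTo-∷ʳ m))) (ListP.map-++ ρ (upTo m) (m ∷ []))

  prefix-length : ∀ ρ m → length (prefix G ρ m) ≡ m
  prefix-length ρ m = trans (ListP.length-map ρ (upTo m)) (ListP.length-upTo m)

  prefix-cong : ∀ ρ ρ′ m → (∀ t → t < m → ρ t ≡ ρ′ t) → prefix G ρ m ≡ prefix G ρ′ m
  prefix-cong ρ ρ′ zero    _    = refl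
  prefix-cong ρ ρ′ (suc m) same rewrite prefix-suc ρ m | prefix-suc ρ′ m =
    cong₂ _∷ʳ_ (prefix-cong ρ ρ′ m (λ t t<m → same t (ℕP.m≤n⇒m≤1+n t<m))) (same m ℕP.≤-refl)

  ConsistentUpTo : Strategy G → ℕ → Play G → Set
  ConsistentUpTo S J g =
    (g 0 ≡ v₀) ×
    (∀ m → m < J → E (g m) (g (suc m)) ≡ true) ×
    (∀ m → m < J → owner (g m) ≡ P1 → g (suc m) ≡ choose S (prefix G g m) (g m))

  consistentUpTo? : ∀ S J g → Dec (ConsistentUpTo S J g)
  consistentUpTo? S J g =
    (g 0 FinP.≟ v₀) ×-dec
    all<? (λ m → E (g m) (g (suc m)) Bool.≟ true) J ×-dec
    all<? (λ m → isP1? (owner (g m)) →-dec (g (suc m) FinP.≟ choose S (prefix G g m) (g m))) J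

  consistent⇒upTo : ∀ {S ρ} J → ConsistentPlay G S ρ → ConsistentUpTo S J ρ
  consistent⇒upTo J (start , edge , choice) = start , (λ m _ → edge m) , (λ m _ → choice m)

  upTo-cong : ∀ {S J g g′} → (∀ m → m ≤ J → g m ≡ g′ m) → ConsistentUpTo S J g → ConsistentUpTo S J g′
  upTo-cong {S} {J} {g} {g′} same (start , edge , choice) =
    trans (sym (same 0 z≤n)) start ,
    (λ m m<J → subst₂ (λ u v → E u v ≡ true) (same m (ℕP.<⇒≤ m<J)) (same (suc m) m<J) (edge m m<J)) ,
    (λ m m<J owns → choice′ m m<J owns)
    where
    choice′ : ∀ m → m < J → owner (g′ m) ≡ P1 → g′ (suc m) ≡ choose S (prefix G g′ m) (g′ m)
    choice′ m m<J owns
      rewrite sym (same m (ℕP.<⇒≤ m<J)) | sym (same (suc m) m<J)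
            | prefix-cong g′ g m (λ t t<m → sym (same t (ℕP.<⇒≤ (ℕP.<-trans t<m m<J)))) =
      choice m m<J owns

  upTo-suc : ∀ {S J g} → ConsistentUpTo S J g → E (g J) (g (suc J)) ≡ true →
             (owner (g J) ≡ P1 → g (suc J) ≡ choose S (prefix G g J) (g J)) →
             ConsistentUpTo S (suc J) g
  upTo-suc {S} {J} {g} (start , edge , choice) lastEdge lastChoice = start , edge′ , choice′
    where
    edge′ : ∀ m → m < suc J → E (g m) (g (suc m)) ≡ true
    edge′ m m<1+J with ℕP.m≤n⇒m<n∨m≡n (s≤s⁻¹ m<1+J)
    ... | inj₁ m<J = edge m m<J
    ... | inj₂ refl = lastEdge
    choice′ : ∀ m → m < suc J → owner (g m) ≡ P1 → g (suc m) ≡ choose S (prefix G g m) (g m)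
    choice′ m m<1+J with ℕP.m≤n⇒m<n∨m≡n (s≤s⁻¹ m<1+J)
    ... | inj₁ m<J = choice m m<J
    ... | inj₂ refl = lastChoice

  graft-consistent : ∀ {S ρ} j u → ConsistentPlay G S ρ → E (ρ j) u ≡ true →
                     (owner (ρ j) ≡ P1 → u ≡ choose S (prefix G ρ j) (ρ j)) →
                     ConsistentUpTo S (suc j) (graft ρ j u)
  graft-consistent {S} {ρ} j u c edge move = upTo-suc {S} {j}
    (upTo-cong {S} {j} {ρ} (λ m m≤j → sym (graft-≤ ρ j u m m≤j)) (consistent⇒upTo {S} j c))
    (subst₂ (λ a b → E a b ≡ true) (sym old) (sym (graft-suc ρ j u)) edge)
    (λ owns → trans (graft-suc ρ j u)
       (trans (move (subst (λ a → owner a ≡ P1) old owns))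
              (cong₂ (choose S) (prefix-cong ρ (graft ρ j u) j (λ t t<j → sym (graft-≤ ρ j u t (ℕP.<⇒≤ t<j))))
                                (sym old))))
    where
    old : graft ρ j u j ≡ ρ j
    old = graft-≤ ρ j u j ℕP.≤-refl

  module _ (nde : NoDeadEnds G) (S : Strategy G) where

    defaultMove : List (Fin n) → Fin n → Fin n
    defaultMove h v with owner v
    ... | P1 = choose S h v
    ... | P2 = proj₁ (nde v)

    defaultMove-edge : ∀ h v → E v (defaultMove h v) ≡ true
    defaultMove-edge h v with owner v in owns
    ... | P1 = legal S h v owns
    ... | P2 = proj₂ (nde v)

    defaultMove-choice : ∀ h v → owner v ≡ P1 → defaultMove h v ≡ choose S h v
    defaultMove-choice h v owns with owner v
    defaultMove-choice h v refl | P1 = refl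

    run : (List (Fin n) → Fin n → Fin n) → ℕ → List (Fin n) × Fin n
    run F zero    = [] , v₀
    run F (suc m) = (proj₁ (run F m) ∷ʳ proj₂ (run F m)) , F (proj₁ (run F m)) (proj₂ (run F m))

    generate : (List (Fin n) → Fin n → Fin n) → Play G
    generate F m = proj₂ (run F m)

    run-history : ∀ F m → proj₁ (run F m) ≡ prefix G (generate F) m
    run-history F zero    = refl
    run-history F (suc m) =
      trans (cong (_∷ʳ generate F m) (run-history F m)) (sym (prefix-suc (generate F) m))

    generate-suc : ∀ F m → generate F (suc m) ≡ F (prefix G (generate F) m) (generate F m)
    generate-suc F m = cong (λ h → F h (generate F m)) (run-history F m)

    continue : Play G → ℕ → List (Fin n) → Fin n → Fin n
    continue g J h v with length h <? J
    ... | yes _ = g (suc (length h))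
    ... | no  _ = defaultMove h v

    continue-spec : ∀ g J h v → (length h < J × continue g J h v ≡ g (suc (length h))) ⊎
                                (¬ length h < J × continue g J h v ≡ defaultMove h v)
    continue-spec g J h v with length h <? J
    ... | yes h<J = inj₁ (h<J , refl)
    ... | no  h≮J = inj₂ (h≮J , refl)

    continue-step : ∀ g J m → let ρ = generate (continue g J) in
                    (m < J × ρ (suc m) ≡ g (suc m)) ⊎ (¬ m < J × ρ (suc m) ≡ defaultMove (prefix G ρ m) (ρ m))
    continue-step g J m with continue-spec g J (prefix G ρ m) (ρ m) | prefix-length ρ m
      where ρ = generate (continue g J)
    ... | inj₁ (h<J , next) | |h|≡m = inj₁ (subst (_< J) |h|≡m h<J ,
        trans (generate-suc (continue g J) m) (trans next (cong (λ ℓ → g (suc ℓ)) |h|≡m)))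
    ... | inj₂ (h≮J , next) | |h|≡m = inj₂ (subst (λ ℓ → ¬ ℓ < J) |h|≡m h≮J ,
        trans (generate-suc (continue g J) m) next)

    extendWalk : ∀ J g → ConsistentUpTo S J g →
                 Σ (Play G) λ ρ → ConsistentPlay G S ρ × (∀ m → m ≤ J → ρ m ≡ g m)
    extendWalk J g (g-start , g-edge , g-choice) = ρ , (trans (agree 0 z≤n) g-start , edge , choice) , agree
      where
      ρ = generate (continue g J)
      agree : ∀ m → m ≤ J → ρ m ≡ g m
      agree zero    _      = sym g-start
      agree (suc m) 1+m≤J with continue-step g J m
      ... | inj₁ (_ , next)   = next
      ... | inj₂ (m≮J , _)    = ⊥-elim (m≮J 1+m≤J)
      edge : ∀ m → E (ρ m) (ρ (suc m)) ≡ true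
      edge m with continue-step g J m
      ... | inj₁ (m<J , next) = subst₂ (λ u v → E u v ≡ true) (sym (agree m (ℕP.<⇒≤ m<J))) (sym next) (g-edge m m<J)
      ... | inj₂ (_ , next)   = subst (λ v → E (ρ m) v ≡ true) (sym next) (defaultMove-edge _ _)
      choice : ∀ m → owner (ρ m) ≡ P1 → ρ (suc m) ≡ choose S (prefix G ρ m) (ρ m)
      choice m owns with continue-step g J m
      ... | inj₂ (_ , next)   = trans next (defaultMove-choice _ _ owns)
      ... | inj₁ (m<J , next) rewrite agree m (ℕP.<⇒≤ m<J)
                                    | prefix-cong ρ g m (λ t t<m → agree t (ℕP.<⇒≤ (ℕP.<-trans t<m m<J))) =
        trans next (g-choice m m<J owns)

  LegalChoices : Vec (Fin n) n → Set
  LegalChoices x = ∀ v → owner v ≡ P1 → E v (Vec.lookup x v) ≡ true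

  memoryless : (x : Vec (Fin n) n) → LegalChoices x → Strategy G
  memoryless x legal = record { choose = λ _ v → Vec.lookup x v ; legal = λ _ v → legal v }

  MemorylessWinning : (Fin n → Thr) → Set
  MemorylessWinning ν =
    Σ (Vec (Fin n) n) λ x → Σ (LegalChoices x) λ legal → Winning G ν (memoryless x legal)

  -- From a winning strategy σ we build, classically, a memoryless winning strategy τ:
  -- at each vertex τ plays what σ plays after a history of ⊑-least key reaching it.
  module _ (nde : NoDeadEnds G) (σ : Strategy G) (ν : Fin n → Thr) (win : Winning G ν σ) where

    record History (v : Fin n) : Set where
      constructor history
      field
        play       : Play G
        len        : ℕ
        consistent : ConsistentPlay G σ play
        ends       : play len ≡ v
    open History

    key : ∀ {v} → History v → Key
    key h = keyFrom (0 , + 0) (play h) 0 (len h)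

    σ-move : ∀ {v} → History v → Fin n
    σ-move {v} h = choose σ (prefix G (play h) (len h)) v

    history-threshold : ∀ {v} (h : History v) → weightOf (key h) ≥ν ν v
    history-threshold (history ρ j c refl) =
      subst (_≥ν ν (ρ j)) (sym (weightOf-keyFrom ρ j)) (proj₂ (win ρ c) j)

    history-bound : ∀ {v} (h : History v) → Within 0 0 n (key h)
    history-bound (history ρ j c _) =
      subst (λ L → Within 0 0 L (keyFrom (0 , + 0) ρ 0 j)) |allFin|≡n
        (keyWithin (proj₁ (win ρ c)) (proj₁ (proj₂ c)) n (allFin n) (ℕP.≤-reflexive |allFin|≡n)
          0 j (0 , + 0) (z≤n , above-0 0) (λ t _ → ∈-allFin _))
      where
      |allFin|≡n : length (allFin n) ≡ n
      |allFin|≡n = ListP.length-tabulate (λ v → v)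

    emptyHistory : ∀ {v} → v ≡ v₀ → History v
    emptyHistory v≡v₀ =
      let (ρ , c , _) = extendWalk nde σ 0 (λ _ → v₀) (refl , (λ _ ()) , (λ _ ()))
      in history ρ 0 c (trans (proj₁ c) (sym v≡v₀))

    extendHistory : ∀ {v} (h : History v) u → E v u ≡ true → (owner v ≡ P1 → u ≡ σ-move h) →
                    Σ (History u) λ h′ → key h′ ≡ stepK (key h) (w v u)
    extendHistory (history ρ j c refl) u edge move =
      history ρ′ (suc j) (proj₁ (proj₂ extended)) new ,
      cong₂ stepK (keyFrom-cong _ ρ′ ρ 0 0 j old) (cong₂ w (old j ℕP.≤-refl) new)
      where
      extended = extendWalk nde σ (suc j) (graft ρ j u) (graft-consistent {σ} j u c edge move)
      ρ′ = proj₁ extended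
      old : ∀ m → m ≤ j → ρ′ m ≡ ρ m
      old m m≤j = trans (proj₂ (proj₂ extended) m (ℕP.m≤n⇒m≤1+n m≤j)) (graft-≤ ρ j u m m≤j)
      new : ρ′ (suc j) ≡ u
      new = trans (proj₂ (proj₂ extended) (suc j) ℕP.≤-refl) (graft-suc ρ j u)

    MinimalHistory : Fin n → Set
    MinimalHistory v = Σ (History v) λ h → ∀ (h′ : History v) → key h ⊑ key h′

    -- Classically every reachable vertex has a history of least key: keys of histories
    -- are bounded, so their ranks live in ℕ × ℕ, where least elements exist.
    ¬¬-minimal : ∀ {v} → History v → ¬ ¬ MinimalHistory v
    ¬¬-minimal {v} h₀ = ¬¬-map minimal (¬¬-lexLeast Ranked _ _ (h₀ , refl , refl))
      where
      rk : History v → ℕ × ℕ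
      rk h = rank n (maxW G * n) (key h)
      Ranked : ℕ → ℕ → Set
      Ranked a b = Σ (History v) λ h → proj₁ (rk h) ≡ a × proj₂ (rk h) ≡ b
      minimal : LexLeast Ranked → MinimalHistory v
      minimal (_ , _ , (h , refl , refl) , least) = h , λ h′ →
        let (c≤n , t≥) = history-bound h ; (c′≤n , t′≥) = history-bound h′
        in rank-⊑ c≤n c′≤n t≥ t′≥ (least _ _ (h′ , refl , refl))

    Choice : Fin n → Set
    Choice v = ¬ History v ⊎ MinimalHistory v

    ¬¬-choice : ∀ v → ¬ ¬ Choice v
    ¬¬-choice v noChoice = ¬¬-excluded-middle {A = History v} λ where
      (yes h)   → ¬¬-minimal h λ m → noChoice (inj₂ m)
      (no none) → noChoice (inj₁ none)

    module Selection (select : ∀ v → Choice v) where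

      τ-at : ∀ v → Choice v → Fin n
      τ-at v (inj₁ _)       = proj₁ (nde v)
      τ-at v (inj₂ (h , _)) = σ-move h

      κ-at : ∀ v → Choice v → Key
      κ-at v (inj₁ _)       = 0 , + 0
      κ-at v (inj₂ (h , _)) = key h

      τ : Fin n → Fin n
      τ v = τ-at v (select v)

      κ : Fin n → Key
      κ v = κ-at v (select v)

      τ-legal : ∀ v → owner v ≡ P1 → E v (τ v) ≡ true
      τ-legal v owns with select v
      ... | inj₁ _       = proj₂ (nde v)
      ... | inj₂ (h , _) = legal σ _ v owns

      record Selected (v : Fin n) (τv : Fin n) (κv : Key) : Set where
        field
          hist    : History v
          κ≡      : κv ≡ key hist
          minimal : ∀ (h′ : History v) → key hist ⊑ key h′
          τ≡      : τv ≡ σ-move hist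

      selected-at : ∀ {v} → History v → (ch : Choice v) → Selected v (τ-at v ch) (κ-at v ch)
      selected-at h (inj₁ none)      = ⊥-elim (none h)
      selected-at h (inj₂ (h* , min)) = record { hist = h* ; κ≡ = refl ; minimal = min ; τ≡ = refl }

      selected : ∀ {v} → History v → Selected v (τ v) (κ v)
      selected {v} h = selected-at h (select v)

      κ-⊑ : ∀ {v} (h : History v) → κ v ⊑ key h
      κ-⊑ h = subst (_⊑ key h) (sym κ≡) (minimal h)
        where open Selected (selected h)

      choices : Vec (Fin n) n
      choices = Vec.tabulate τ

      choices-legal : LegalChoices choices
      choices-legal v owns = subst (λ u → E v u ≡ true) (sym (VecP.lookup∘tabulate τ v)) (τ-legal v owns)

      τ-strategy : Strategy G
      τ-strategy = memoryless choices choices-legal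

      module _ {ρ : Play G} (c : ConsistentPlay G τ-strategy ρ) where

        next : ∀ m → History (ρ m) →
               Σ (History (ρ (suc m))) λ h′ → key h′ ≡ stepK (κ (ρ m)) (w (ρ m) (ρ (suc m)))
        next m h =
          let (h′ , key≡) = extendHistory hist (ρ (suc m)) (proj₁ (proj₂ c) m) τ-move
          in h′ , trans key≡ (cong (λ κ′ → stepK κ′ (w (ρ m) (ρ (suc m)))) (sym κ≡))
          where
          open Selected (selected h)
          τ-move : owner (ρ m) ≡ P1 → ρ (suc m) ≡ σ-move hist
          τ-move owns = trans (proj₂ (proj₂ c) m owns) (trans (VecP.lookup∘tabulate τ (ρ m)) τ≡)

        reach : ∀ m → History (ρ m)
        reach zero    = emptyHistory (proj₁ c)
        reach (suc m) = proj₁ (next m (reach m))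

        κ-step : ∀ m → κ (ρ (suc m)) ⊑ stepK (κ (ρ m)) (w (ρ m) (ρ (suc m)))
        κ-step m = let (h′ , key≡) = next m (reach m) in subst (κ (ρ (suc m)) ⊑_) key≡ (κ-⊑ h′)

        κ-telescope : ∀ i k → κ (ρ (i + k)) ⊑ keyFrom (κ (ρ i)) ρ i k
        κ-telescope i zero    = subst (λ m → κ (ρ m) ⊑ κ (ρ i)) (sym (ℕP.+-identityʳ i)) (⊑-refl _)
        κ-telescope i (suc k) = subst (λ m → κ (ρ m) ⊑ keyFrom (κ (ρ i)) ρ i (suc k)) (sym (ℕP.+-suc i k))
          (⊑-trans (κ-step (i + k)) (stepK-mono (w (ρ (i + k)) (ρ (suc (i + k)))) (κ-telescope i k)))

        -- A cycle returns to the same κ, hence cannot decrease the key.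
        τ-noBadCycle : NoBadCycle ρ
        τ-noBadCycle i k _ ρi≡ρi+k =
          keyFrom-nn (κ (ρ i)) ρ i k (subst (λ v → κ v ⊑ keyFrom (κ (ρ i)) ρ i k) (sym ρi≡ρi+k) (κ-telescope i k))

        -- The prefix weight dominates the weight of a minimal history, which meets the threshold.
        τ-threshold : ∀ j → segW G ρ 0 j ≥ν ν (ρ j)
        τ-threshold j = ≥ν-mono (ν (ρ j)) prefix-dominates (subst (_≥ν ν (ρ j)) (cong weightOf (sym κ≡)) (history-threshold hist))
          where
          open Selected (selected (reach j))
          prefix-dominates : weightOf (κ (ρ j)) ≤w segW G ρ 0 j
          prefix-dominates = subst (weightOf (κ (ρ j)) ≤w_) (weightOf-keyFrom ρ j)
            (weightOf-mono (⊑-trans (κ-telescope 0 j) (keyFrom-mono ρ 0 j (κ-⊑ (emptyHistory (proj₁ c))))))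

      τ-winning : Winning G ν τ-strategy
      τ-winning ρ c = τ-noBadCycle c , τ-threshold c

    ¬¬-memorylessWinning : ¬ ¬ MemorylessWinning ν
    ¬¬-memorylessWinning = ¬¬-map (λ select → let open Selection select in choices , choices-legal , τ-winning)
                                  (¬¬-finiteChoice Choice ¬¬-choice)

  record Repeat (ρ : Play G) (a : ℕ) : Set where
    field
      offset period : ℕ
      period>0      : 0 < period
      short         : offset + period ≤ n
      repeats       : ρ (a + offset) ≡ ρ (a + offset + period)

  repeat : ∀ ρ a → Repeat ρ a
  repeat ρ a with FinP.pigeonhole (ℕP.n<1+n n) (λ i → ρ (a + toℕ i))
  ... | i , j , i<j , same with ℕP.m≤n⇒∃[o]m+o≡n i<j
  ... | p , i+1+p≡j = record
    { offset = toℕ i ; period = suc p ; period>0 = s≤s z≤n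
    ; short = subst (_≤ n) (sym i+[1+p]≡j) (ℕP.m<1+n⇒m≤n (FinP.toℕ<n j))
    ; repeats = trans same (cong ρ (trans (cong (λ x → a + x) (sym i+[1+p]≡j)) (sym (ℕP.+-assoc a (toℕ i) (suc p))))) }
    where
    i+[1+p]≡j : toℕ i + suc p ≡ toℕ j
    i+[1+p]≡j = trans (ℕP.+-suc (toℕ i) p) i+1+p≡j

  cut-removes-cycle : ∀ ρ i e d q → ρ (i + e) ≡ ρ (i + e + d) → NN (segW G ρ (i + e) d) →
                      segW G (cut ρ (i + e) d) i (e + q) ≤w segW G ρ i (e + d + q)
  cut-removes-cycle ρ i e d q repeats nnC = subst₂ _≤w_ (sym shortened) (sym original) (nn-insert A C B nnC)
    where
    open ≡-Reasoning
    ρ′ = cut ρ (i + e) d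
    A = segW G ρ i e
    C = segW G ρ (i + e) d
    B = segW G ρ (i + e + d) q
    original : segW G ρ i (e + d + q) ≡ (A ⊕ C) ⊕ B
    original = begin
      segW G ρ i (e + d + q)                         ≡⟨ segW-++ ρ i (e + d) q ⟩
      segW G ρ i (e + d) ⊕ segW G ρ (i + (e + d)) q  ≡⟨ cong₂ _⊕_ (segW-++ ρ i e d)
                                                              (cong (λ p → segW G ρ p q) (sym (ℕP.+-assoc i e d))) ⟩
      (A ⊕ C) ⊕ B                                    ∎
    shortened : segW G ρ′ i (e + q) ≡ A ⊕ B
    shortened = begin
      segW G ρ′ i (e + q)                  ≡⟨ segW-++ ρ′ i e q ⟩
      segW G ρ′ i e ⊕ segW G ρ′ (i + e) q  ≡⟨ cong₂ _⊕_
          (segW-cong ρ′ ρ i i e (λ t t≤e → cut-≤ ρ (i + e) d (i + t) (ℕP.+-monoʳ-≤ i t≤e)))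
          (segW-cong ρ′ ρ (i + e) (i + e + d) q (λ t _ → cut-after ρ (i + e) d repeats t)) ⟩
      A ⊕ B                                ∎

  -- For memoryless strategies, winning is decidable: a cycle can be cut out of a
  -- consistent play, leaving a consistent play, so every cycle and every prefix weight
  -- reduces to one within the first 2n steps, where there are finitely many walks.
  module _ (nde : NoDeadEnds G) (S : Strategy G) (mem : Memoryless G S) (ν : Fin n → Thr) where

    consistent-from-steps : ∀ {ρ ρ′} → ConsistentPlay G S ρ → ρ′ 0 ≡ v₀ →
      (∀ m → Σ ℕ λ m′ → ρ′ m ≡ ρ m′ × ρ′ (suc m) ≡ ρ (suc m′)) → ConsistentPlay G S ρ′
    consistent-from-steps {ρ} {ρ′} (_ , edge , choice) start steps = start , edge′ , choice′
      where
      edge′ : ∀ m → E (ρ′ m) (ρ′ (suc m)) ≡ true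
      edge′ m with steps m
      ... | m′ , now , next rewrite now | next = edge m′
      choice′ : ∀ m → owner (ρ′ m) ≡ P1 → ρ′ (suc m) ≡ choose S (prefix G ρ′ m) (ρ′ m)
      choice′ m with steps m
      ... | m′ , now , next rewrite now | next = λ owns → trans (choice m′ owns) (mem _ _ _)

    cut-consistent : ∀ {ρ} b d → ConsistentPlay G S ρ → ρ b ≡ ρ (b + d) → ConsistentPlay G S (cut ρ b d)
    cut-consistent {ρ} b d c repeats = consistent-from-steps c (trans (cut-≤ ρ b d 0 z≤n) (proj₁ c)) steps
      where
      steps : ∀ m → Σ ℕ λ m′ → cut ρ b d m ≡ ρ m′ × cut ρ b d (suc m) ≡ ρ (suc m′)
      steps m with b ≤? m
      ... | no  m<b = m , cut-≤ ρ b d m (ℕP.<⇒≤ (ℕP.≰⇒> m<b)) , cut-≤ ρ b d (suc m) (ℕP.≰⇒> m<b)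
      ... | yes b≤m with ℕP.m≤n⇒∃[o]m+o≡n b≤m
      ... | t , refl = b + d + t , cut-after ρ b d repeats t ,
                       trans (cong (cut ρ b d) (sym (ℕP.+-suc b t)))
                             (trans (cut-after ρ b d repeats (suc t)) (cong ρ (ℕP.+-suc (b + d) t)))

    horizon : ℕ
    horizon = suc (n + n)

    Bounded : Play G → Set
    Bounded ρ =
      (∀ i k → i + k < horizon → 0 < k → ρ i ≡ ρ (i + k) → NN (segW G ρ i k)) ×
      (∀ j → j < horizon → segW G ρ 0 j ≥ν ν (ρ j))

    bounded-cong : ∀ {ρ ρ′} → (∀ m → m < horizon → ρ m ≡ ρ′ m) → Bounded ρ → Bounded ρ′
    bounded-cong {ρ} {ρ′} same (cycles , thresholds) = cycles′ , thresholds′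
      where
      cycles′ : ∀ i k → i + k < horizon → 0 < k → ρ′ i ≡ ρ′ (i + k) → NN (segW G ρ′ i k)
      cycles′ i k short 0<k ρ′i≡ =
        subst NN (segW-cong ρ ρ′ i i k (λ t t≤k → same (i + t) (ℕP.≤-<-trans (ℕP.+-monoʳ-≤ i t≤k) short)))
          (cycles i k short 0<k (trans (same i (ℕP.≤-<-trans (ℕP.m≤m+n i k) short))
                                  (trans ρ′i≡ (sym (same (i + k) short)))))
      thresholds′ : ∀ j → j < horizon → segW G ρ′ 0 j ≥ν ν (ρ′ j)
      thresholds′ j short = subst₂ (λ x v → x ≥ν ν v)
        (segW-cong ρ ρ′ 0 0 j (λ t t≤j → same t (ℕP.≤-<-trans t≤j short))) (same j short) (thresholds j short)

    bounded? : ∀ ρ → Dec (Bounded ρ)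
    bounded? ρ = Dec.map′ (λ cycles i k short → cycles i (short₁ i k short) k (short₂ i k short) short)
                          (λ cycles i _ k _ → cycles i k)
                   (all<? (λ i → all<? (λ k → cycle? i k) horizon) horizon)
                 ×-dec all<? (λ j → segW G ρ 0 j ≥ν? ν (ρ j)) horizon
      where
      cycle? : ∀ i k → Dec (i + k < horizon → 0 < k → ρ i ≡ ρ (i + k) → NN (segW G ρ i k))
      cycle? i k = (i + k <? horizon) →-dec (0 <? k) →-dec (ρ i FinP.≟ ρ (i + k)) →-dec nn? (segW G ρ i k)
      short₁ : ∀ i k → i + k < horizon → i < horizon
      short₁ i k = ℕP.≤-<-trans (ℕP.m≤m+n i k)
      short₂ : ∀ i k → i + k < horizon → k < horizon
      short₂ i k = ℕP.≤-<-trans (ℕP.m≤n+m k i)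

    ShortWalksGood : Set
    ShortWalksGood = ∀ (x : Vec (Fin n) horizon) → ConsistentUpTo S (n + n) (seqOf x) → Bounded (seqOf x)

    shortWalks-bounded : ShortWalksGood → ∀ {ρ} → ConsistentPlay G S ρ → Bounded ρ
    shortWalks-bounded good {ρ} c = bounded-cong agree (good x (upTo-cong {S} (λ m m≤ → sym (agree m (s≤s m≤)))
                                                                 (consistent⇒upTo {S} (n + n) c)))
      where
      x = Vec.tabulate {n = horizon} (λ i → ρ (toℕ i))
      agree : ∀ m → m < horizon → seqOf x m ≡ ρ m
      agree m m<h = seqOf-tabulate (n + n) ρ m (s≤s⁻¹ m<h)

    CyclesAt : ℕ → Set
    CyclesAt s = ∀ {ρ} → ConsistentPlay G S ρ → ∀ i k → i + k ≡ s → 0 < k → ρ i ≡ ρ (i + k) → NN (segW G ρ i k)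

    -- A cycle starting at i ≥ n reappears at an earlier position once a cycle before it
    -- is cut out.
    cycle-late : ∀ {ρ i k} → (∀ {s} → s < i + k → CyclesAt s) → ConsistentPlay G S ρ → n ≤ i →
                 0 < k → ρ i ≡ ρ (i + k) → NN (segW G ρ i k)
    cycle-late {ρ} {i} {k} earlier c n≤i 0<k cycle with repeat ρ 0
    ... | rep with ℕP.m≤n⇒∃[o]m+o≡n (ℕP.≤-trans (Repeat.short rep) n≤i)
    ... | r , refl = subst NN (segW-cong ρ′ ρ (e + r) (e + d + r) k (λ t _ → shift t))
        (earlier (ℕP.+-monoˡ-< k (ℕP.+-monoˡ-< r (ℕP.m<m+n e period>0))) (cut-consistent e d c repeats)
                 (e + r) k refl 0<k (trans (shift₀) (trans cycle (sym (shift k)))))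
      where
      open Repeat rep renaming (offset to e ; period to d)
      ρ′ = cut ρ e d
      shift : ∀ t → ρ′ (e + r + t) ≡ ρ (e + d + r + t)
      shift t = begin
        ρ′ (e + r + t)       ≡⟨ cong ρ′ (ℕP.+-assoc e r t) ⟩
        ρ′ (e + (r + t))     ≡⟨ cut-after ρ e d repeats (r + t) ⟩
        ρ (e + d + (r + t))  ≡⟨ cong ρ (sym (ℕP.+-assoc (e + d) r t)) ⟩
        ρ (e + d + r + t)    ∎
        where open ≡-Reasoning
      shift₀ : ρ′ (e + r) ≡ ρ (e + d + r)
      shift₀ = cut-after ρ e d repeats r

    -- A cycle longer than n contains a shorter cycle; cutting that out leaves a shorter
    -- cycle whose weight is at most the original one.
    cycle-long : ∀ {ρ i k} → (∀ {s} → s < i + k → CyclesAt s) → ConsistentPlay G S ρ → n < k →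
                 ρ i ≡ ρ (i + k) → NN (segW G ρ i k)
    cycle-long {ρ} {i} {k} earlier c n<k cycle with repeat ρ i
    ... | rep with ℕP.m≤n⇒∃[o]m+o≡n (ℕP.≤-trans (Repeat.short rep) (ℕP.<⇒≤ n<k))
    ... | q , refl = nn-mono outer (cut-removes-cycle ρ i e d q repeats inner)
      where
      open Repeat rep renaming (offset to e ; period to d)
      ρ′ = cut ρ (i + e) d
      inner : NN (segW G ρ (i + e) d)
      inner = earlier (subst (_< i + (e + d + q)) (sym (ℕP.+-assoc i e d)) (ℕP.+-monoʳ-< i (ℕP.≤-<-trans short n<k)))
                c (i + e) d refl period>0 repeats
      positive : ∀ q → n < e + d + q → 0 < e + q
      positive zero    n<e+d+0 = ⊥-elim (ℕP.<⇒≱ n<e+d+0 (subst (_≤ n) (sym (ℕP.+-identityʳ (e + d))) short))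
      positive (suc q) _       = ℕP.≤-trans (s≤s z≤n) (ℕP.m≤n+m (suc q) e)
      reorder : ∀ e d q → e + q + d ≡ e + d + q
      reorder = ℕSolver.solve-∀
      ρ′-cycle : ρ′ i ≡ ρ′ (i + (e + q))
      ρ′-cycle = begin
        ρ′ i                   ≡⟨ cut-≤ ρ (i + e) d i (ℕP.m≤m+n i e) ⟩
        ρ i                    ≡⟨ cycle ⟩
        ρ (i + (e + d + q))    ≡⟨ cong ρ (regroup i e d q) ⟩
        ρ (i + e + d + q)      ≡⟨ sym (cut-after ρ (i + e) d repeats q) ⟩
        ρ′ (i + e + q)         ≡⟨ cong ρ′ (ℕP.+-assoc i e q) ⟩
        ρ′ (i + (e + q))       ∎
        where
        open ≡-Reasoning
        regroup : ∀ i e d q → i + (e + d + q) ≡ i + e + d + q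
        regroup = ℕSolver.solve-∀
      outer : NN (segW G ρ′ i (e + q))
      outer = earlier (ℕP.+-monoʳ-< i (subst (e + q <_) (reorder e d q) (ℕP.m<m+n (e + q) period>0)))
                (cut-consistent (i + e) d c repeats) i (e + q) refl (positive q n<k) ρ′-cycle

    cycles-all : ShortWalksGood → ∀ s → CyclesAt s
    cycles-all good = <-rec CyclesAt step
      where
      step : ∀ s → (∀ {s′} → s′ < s → CyclesAt s′) → CyclesAt s
      step _ earlier c i k refl 0<k cycle with i + k <? horizon | n ≤? i
      ... | yes short | _       = proj₁ (shortWalks-bounded good c) i k short 0<k cycle
      ... | no  _     | yes n≤i = cycle-late earlier c n≤i 0<k cycle
      ... | no  long  | no  n≰i = cycle-long earlier c n<k cycle
        where
        n<k : n < k
        n<k = ℕP.≰⇒> λ k≤n → long (s≤s (ℕP.+-mono-≤ (ℕP.<⇒≤ (ℕP.≰⇒> n≰i)) k≤n))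

    ThresholdAt : ℕ → Set
    ThresholdAt j = ∀ {ρ} → ConsistentPlay G S ρ → segW G ρ 0 j ≥ν ν (ρ j)

    -- A prefix longer than n contains a cycle; cutting it out gives a shorter prefix ending
    -- at the same vertex, of at most the same weight.
    threshold-long : ∀ {ρ j} → (∀ {j′} → j′ < j → ThresholdAt j′) → (∀ s → CyclesAt s) →
                     ConsistentPlay G S ρ → n ≤ j → segW G ρ 0 j ≥ν ν (ρ j)
    threshold-long {ρ} {j} earlier cycles c n≤j with repeat ρ 0
    ... | rep with ℕP.m≤n⇒∃[o]m+o≡n (ℕP.≤-trans (Repeat.short rep) n≤j)
    ... | r , refl = ≥ν-mono (ν (ρ (e + d + r))) (cut-removes-cycle ρ 0 e d r repeats inner)
        (subst (λ v → segW G ρ′ 0 (e + r) ≥ν ν v) (cut-after ρ e d repeats r)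
          (earlier (ℕP.+-monoˡ-< r (ℕP.m<m+n e period>0)) (cut-consistent e d c repeats)))
      where
      open Repeat rep renaming (offset to e ; period to d)
      ρ′ = cut ρ e d
      inner : NN (segW G ρ e d)
      inner = cycles (e + d) c e d refl period>0 repeats

    thresholds-all : ShortWalksGood → ∀ j → ThresholdAt j
    thresholds-all good = <-rec ThresholdAt step
      where
      step : ∀ j → (∀ {j′} → j′ < j → ThresholdAt j′) → ThresholdAt j
      step j earlier c with j <? horizon
      ... | yes short = proj₂ (shortWalks-bounded good c) j short
      ... | no  long  = threshold-long earlier (cycles-all good) c
                          (ℕP.≤-trans (ℕP.m≤m+n n n) (ℕP.≮⇒≥ λ j<n+n → long (ℕP.m<n⇒m<1+n j<n+n)))

    shortWalks⇒winning : ShortWalksGood → Winning G ν S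
    shortWalks⇒winning good ρ c = (λ i k → cycles-all good (i + k) c i k refl) , (λ j → thresholds-all good j c)

    winning⇒shortWalks : Winning G ν S → ShortWalksGood
    winning⇒shortWalks win x walk =
      let (ρ , c , agree) = extendWalk nde S (n + n) (seqOf x) walk
          (noBad , thresholds) = win ρ c
      in bounded-cong (λ m m<h → agree m (s≤s⁻¹ m<h))
           ((λ i k _ 0<k cycle → noBad i k 0<k cycle) , (λ j _ → thresholds j))

    winning? : Dec (Winning G ν S)
    winning? = Dec.map′ shortWalks⇒winning winning⇒shortWalks
      (allVec? horizon λ x → consistentUpTo? S (n + n) (seqOf x) →-dec bounded? (seqOf x))

  memorylessWinning? : NoDeadEnds G → ∀ ν → Dec (MemorylessWinning ν)
  memorylessWinning? nde ν = anyVec? n winningChoices?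
    where
    winningChoices? : ∀ x → Dec (Σ (LegalChoices x) λ legal → Winning G ν (memoryless x legal))
    winningChoices? x with FinP.all? (λ v → isP1? (owner v) →-dec (E v (Vec.lookup x v) Bool.≟ true))
    ... | no illegal = no λ (legal , _) → illegal legal
    ... | yes legal with winning? nde (memoryless x legal) (λ _ _ _ → refl) ν
    ...   | yes wins  = yes (legal , wins)
    ...   | no  loses = no λ (_ , wins) → loses wins

lemma32 : (n : ℕ) (G : Game n) (ν : Fin n → Thr) →
          NoDeadEnds G →
          ThresholdBound G ν →
          (Σ (Strategy G) (λ σ → Winning G ν σ)) ⇔
          (Σ (Strategy G) (λ σ → Memoryless G σ × Winning G ν σ))
lemma32 n G ν nde _ = mk⇔ toMemoryless fromMemoryless
  where
  toMemoryless : Σ (Strategy G) (Winning G ν) → Σ (Strategy G) (λ σ → Memoryless G σ × Winning G ν σ)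
  -- Classically τ exists; as existence is decidable, it exists outright.
  toMemoryless (σ , win) =
    let (x , legal , wins) = decidable-stable (memorylessWinning? G nde ν) (¬¬-memorylessWinning G nde σ ν win)
    in memoryless G x legal , (λ _ _ _ → refl) , wins
  fromMemoryless : Σ (Strategy G) (λ σ → Memoryless G σ × Winning G ν σ) → Σ (Strategy G) (Winning G ν)
  fromMemoryless (σ , _ , wins) = σ , wins
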